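{- The cut rule is admissible in the cut-free fragment of BIS4: for every bunch $\Delta$, every bunched context $\Gamma(-)$ and all formulas $\psi,\varphi$ (of BIS4), if $\Delta\vdash_{\mathsf{cf}}\psi$ and $\Gamma(\psi)\vdash_{\mathsf{cf}}\varphi$ in BIS4, then $\Gamma(\Delta)\vdash_{\mathsf{cf}}\varphi$ in BIS4.
   Context: Formulas of BIS4 are generated by $\varphi,\psi ::= \top \mid \bot \mid \varphi\wedge\psi \mid \varphi\vee\psi \mid \varphi\to\psi \mid \mathsf{emp} \mid \varphi * \psi \mid \varphi \mathrel{ -\!\!*} \psi \mid \Box\varphi \mid a$, with $a$ ranging over a fixed set $\mathrm{Atom}$. Bunches: $\Delta ::= \varphi \mid \varnothing_m \mid \varnothing_a \mid \Delta , \Delta \mid \Delta ; \Delta$. A bunched context $\Delta(-)$ is a bunch with exactly one hole; $\Delta(\Gamma)$ fills it with $\Gamma$. Bunch equivalence $\equiv$ is the least equivalence relation, closed under bunched contexts, making "$,$" commutative and associative with unit $\varnothing_m$ and "$;$" commutative and associative with unit $\varnothing_a$. For a bunch $\Delta$, $\Box\Delta$ is the bunch obtained from $\Delta$ by replacing every formula leaf $\varphi$ with $\Box\varphi$ (empty-bunch leaves unchanged). The BIS4 sequent calculus has the rules: (ax) $a\vdash a$ for $a\in\mathrm{Atom}$; (equiv) from $\Delta'\vdash\varphi$ and $\Delta\equiv\Delta'$ infer $\Delta\vdash\varphi$; (W;) from $\Delta(\Delta_1)\vdash\varphi$ infer $\Delta(\Delta_1;\Delta_2)\vdash\varphi$;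 (C;) from $\Delta(\Delta_1;\Delta_1)\vdash\varphi$ infer $\Delta(\Delta_1)\vdash\varphi$; (cut) from $\Delta'\vdash A$ and $\Delta(A)\vdash B$ infer $\Delta(\Delta')\vdash B$; (empR) $\varnothing_m\vdash\mathsf{emp}$; (empL) from $\Delta(\varnothing_m)\vdash\varphi$ infer $\Delta(\mathsf{emp})\vdash\varphi$; (*R) from $\Delta_1\vdash\varphi$, $\Delta_2\vdash\psi$ infer $\Delta_1,\Delta_2\vdash\varphi*\psi$; (*L) from $\Delta(\varphi,\psi)\vdash\chi$ infer $\Delta(\varphi*\psi)\vdash\chi$; ($-\!*$R) from $\Delta,\varphi\vdash\psi$ infer $\Delta\vdash\varphi\mathrel{ -\!\!*}\psi$; ($-\!*$L) from $\Delta_1\vdash\varphi$ and $\Delta(\Delta_2,\psi)\vdash\chi$ infer $\Delta((\Delta_1,\Delta_2),\varphi\mathrel{ -\!\!*}\psi)\vdash\chi$; ($\top$R) $\varnothing_a\vdash\top$; ($\top$L) from $\Delta(\varnothing_a)\vdash\varphi$ infer $\Delta(\top)\vdash\varphi$; ($\wedge$R) from $\Delta_1\vdash\varphi$, $\Delta_2\vdash\psi$ infer $\Delta_1;\Delta_2\vdash\varphi\wedge\psi$; ($\wedge$L) from $\Delta(\varphi;\psi)\vdash\chi$ infer $\Delta(\varphi\wedge\psi)\vdash\chi$; ($\to$R) from $\Delta;\varphi\vdash\psi$ infer $\Delta\vdash\varphi\to\psi$; ($\to$L) from $\Delta_1\vdash\varphi$ and $\Delta(\Delta_2;\psi)\vdash\chi$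 infer $\Delta((\Delta_1;\Delta_2);\varphi\to\psi)\vdash\chi$; ($\bot$L) $\Delta(\bot)\vdash\varphi$; ($\vee$R1/2) from $\Delta\vdash\varphi$ (resp. $\Delta\vdash\psi$) infer $\Delta\vdash\varphi\vee\psi$; ($\vee$L) from $\Delta(\varphi)\vdash\chi$ and $\Delta(\psi)\vdash\chi$ infer $\Delta(\varphi\vee\psi)\vdash\chi$; ($\Box$R) from $\Box\Delta\vdash A$ infer $\Box\Delta\vdash\Box A$; ($\Box$L) from $\Delta(A)\vdash B$ infer $\Delta(\Box A)\vdash B$. $\Delta\vdash_{\mathsf{cf}}\varphi$ (in BIS4) means $\Delta\vdash\varphi$ is derivable in this calculus without (cut). -}

module Defs where

module BIS4 (Atom : Set) where

  infixr 30 _∧'_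
  infixr 25 _∨'_
  infixr 20 _⇒_
  infixr 30 _✱_
  infixr 20 _-✱_

  data Formula : Set where
    ⊤'   : Formula
    ⊥'   : Formula
    _∧'_ : Formula → Formula → Formula
    _∨'_ : Formula → Formula → Formula
    _⇒_  : Formula → Formula → Formula
    emp  : Formula
    _✱_  : Formula → Formula → Formula
    _-✱_ : Formula → Formula → Formula
    □    : Formula → Formula
    atom : Atom → Formula

  data Bunch : Set where
    form : Formula → Bunch
    ∅m   : Bunch
    ∅a   : Bunch
    _,,_ : Bunch → Bunch → Bunch
    _⨾_  : Bunch → Bunch → Bunch

  data Ctx : Set where
    hole : Ctx
    _,,ˡ_ : Ctx → Bunch → Ctx
    _,,ʳ_ : Bunch → Ctx → Ctx
    _⨾ˡ_  : Ctx → Bunch → Ctx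
    _⨾ʳ_  : Bunch → Ctx → Ctx

  _[_] : Ctx → Bunch → Bunch
  hole [ Γ ] = Γ
  (C ,,ˡ B) [ Γ ] = (C [ Γ ]) ,, B
  (B ,,ʳ C) [ Γ ] = B ,, (C [ Γ ])
  (C ⨾ˡ B) [ Γ ] = (C [ Γ ]) ⨾ B
  (B ⨾ʳ C) [ Γ ] = B ⨾ (C [ Γ ])

  □B : Bunch → Bunch
  □B (form φ) = form (□ φ)
  □B ∅m = ∅m
  □B ∅a = ∅a
  □B (Δ₁ ,, Δ₂) = □B Δ₁ ,, □B Δ₂
  □B (Δ₁ ⨾ Δ₂) = □B Δ₁ ⨾ □B Δ₂

  data _≡B_ : Bunch → Bunch → Set where
    ≡-refl  : ∀ {Δ} → Δ ≡B Δ
    ≡-sym   : ∀ {Δ Δ'} → Δ ≡B Δ' → Δ' ≡B Δ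
    ≡-trans : ∀ {Δ Δ' Δ''} → Δ ≡B Δ' → Δ' ≡B Δ'' → Δ ≡B Δ''
    ≡-ctx   : ∀ C {Δ Δ'} → Δ ≡B Δ' → (C [ Δ ]) ≡B (C [ Δ' ])
    ,-comm  : ∀ {Δ₁ Δ₂} → (Δ₁ ,, Δ₂) ≡B (Δ₂ ,, Δ₁)
    ,-assoc : ∀ {Δ₁ Δ₂ Δ₃} → ((Δ₁ ,, Δ₂) ,, Δ₃) ≡B (Δ₁ ,, (Δ₂ ,, Δ₃))
    ,-unit  : ∀ {Δ} → (Δ ,, ∅m) ≡B Δ
    ⨾-comm  : ∀ {Δ₁ Δ₂} → (Δ₁ ⨾ Δ₂) ≡B (Δ₂ ⨾ Δ₁)
    ⨾-assoc : ∀ {Δ₁ Δ₂ Δ₃} → ((Δ₁ ⨾ Δ₂) ⨾ Δ₃) ≡B (Δ₁ ⨾ (Δ₂ ⨾ Δ₃))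
    ⨾-unit  : ∀ {Δ} → (Δ ⨾ ∅a) ≡B Δ

  infix 5 _⊢cf_
  data _⊢cf_ : Bunch → Formula → Set where
    ax    : ∀ a → form (atom a) ⊢cf atom a
    equiv : ∀ {Δ Δ' φ} → Δ' ⊢cf φ → Δ ≡B Δ' → Δ ⊢cf φ
    W⨾    : ∀ C {Δ₁ Δ₂ φ} → C [ Δ₁ ] ⊢cf φ → C [ Δ₁ ⨾ Δ₂ ] ⊢cf φ
    C⨾    : ∀ C {Δ₁ φ} → C [ Δ₁ ⨾ Δ₁ ] ⊢cf φ → C [ Δ₁ ] ⊢cf φ
    empR  : ∅m ⊢cf emp
    empL  : ∀ C {φ} → C [ ∅m ] ⊢cf φ → C [ form emp ] ⊢cf φ
    ✱R    : ∀ {Δ₁ Δ₂ φ ψ} → Δ₁ ⊢cf φ → Δ₂ ⊢cf ψ → (Δ₁ ,, Δ₂) ⊢cf φ ✱ ψ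
    ✱L    : ∀ C {φ ψ χ} → C [ form φ ,, form ψ ] ⊢cf χ → C [ form (φ ✱ ψ) ] ⊢cf χ
    -✱R   : ∀ {Δ φ ψ} → (Δ ,, form φ) ⊢cf ψ → Δ ⊢cf φ -✱ ψ
    -✱L   : ∀ C {Δ₁ Δ₂ φ ψ χ} → Δ₁ ⊢cf φ → C [ Δ₂ ,, form ψ ] ⊢cf χ →
            C [ (Δ₁ ,, Δ₂) ,, form (φ -✱ ψ) ] ⊢cf χ
    ⊤R    : ∅a ⊢cf ⊤'
    ⊤L    : ∀ C {φ} → C [ ∅a ] ⊢cf φ → C [ form ⊤' ] ⊢cf φ
    ∧R    : ∀ {Δ₁ Δ₂ φ ψ} → Δ₁ ⊢cf φ → Δ₂ ⊢cf ψ → (Δ₁ ⨾ Δ₂) ⊢cf φ ∧' ψ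
    ∧L    : ∀ C {φ ψ χ} → C [ form φ ⨾ form ψ ] ⊢cf χ → C [ form (φ ∧' ψ) ] ⊢cf χ
    ⇒R    : ∀ {Δ φ ψ} → (Δ ⨾ form φ) ⊢cf ψ → Δ ⊢cf φ ⇒ ψ
    ⇒L    : ∀ C {Δ₁ Δ₂ φ ψ χ} → Δ₁ ⊢cf φ → C [ Δ₂ ⨾ form ψ ] ⊢cf χ →
            C [ (Δ₁ ⨾ Δ₂) ⨾ form (φ ⇒ ψ) ] ⊢cf χ
    ⊥L    : ∀ C {φ} → C [ form ⊥' ] ⊢cf φ
    ∨R₁   : ∀ {Δ φ ψ} → Δ ⊢cf φ → Δ ⊢cf φ ∨' ψ
    ∨R₂   : ∀ {Δ φ ψ} → Δ ⊢cf ψ → Δ ⊢cf φ ∨' ψ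
    ∨L    : ∀ C {φ ψ χ} → C [ form φ ] ⊢cf χ → C [ form ψ ] ⊢cf χ →
            C [ form (φ ∨' ψ) ] ⊢cf χ
    □R    : ∀ {Δ A} → □B Δ ⊢cf A → □B Δ ⊢cf □ A
    □L    : ∀ C {A B} → C [ form A ] ⊢cf B → C [ form (□ A) ] ⊢cf B

-- Induction on the cut formula ψ.  For a fixed ψ the cut is first permuted
-- upwards through the left derivation Δ ⊢ ψ until that derivation ends in a
-- right rule.  The right derivation Γ(ψ) ⊢ φ cannot simply be traversed with
-- a single occurrence of ψ, because contraction (C⨾) duplicates it; instead
-- all occurrences of ψ descending from the cut formula are marked and
-- replaced by Δ simultaneously (a multicut).  When a marked occurrence is
-- principal in a left rule, the cut reduces to cuts on the immediate
-- subformulas of ψ.  In the case of (□R) the marked occurrences are boxed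
-- formulas □ a, whose right-rule derivations end in (□R) and so have boxed
-- antecedents; the replaced bunch is therefore still boxed.
module Submission where

open import Defs
open import Data.Empty using (⊥-elim)
open import Data.Product using (Σ-syntax; _×_; _,_; proj₁; swap)
open import Data.Unit using (⊤; tt)
open import Relation.Nullary using (¬_)
open import Relation.Binary.PropositionalEquality using (_≡_; refl; sym; trans; cong; cong₂; subst; subst₂)

module CutAdmissibility (Atom : Set) where
  open BIS4 Atom

  _∘ᶜ_ : Ctx → Ctx → Ctx
  hole ∘ᶜ K = K
  (C ,,ˡ B) ∘ᶜ K = (C ∘ᶜ K) ,,ˡ B
  (B ,,ʳ C) ∘ᶜ K = B ,,ʳ (C ∘ᶜ K)
  (C ⨾ˡ B) ∘ᶜ K = (C ∘ᶜ K) ⨾ˡ B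
  (B ⨾ʳ C) ∘ᶜ K = B ⨾ʳ (C ∘ᶜ K)

  ∘ᶜ-[] : ∀ C K X → (C ∘ᶜ K) [ X ] ≡ C [ K [ X ] ]
  ∘ᶜ-[] hole K X = refl
  ∘ᶜ-[] (C ,,ˡ B) K X = cong (_,, B) (∘ᶜ-[] C K X)
  ∘ᶜ-[] (B ,,ʳ C) K X = cong (B ,,_) (∘ᶜ-[] C K X)
  ∘ᶜ-[] (C ⨾ˡ B) K X = cong (_⨾ B) (∘ᶜ-[] C K X)
  ∘ᶜ-[] (B ⨾ʳ C) K X = cong (B ⨾_) (∘ᶜ-[] C K X)

  nest : ∀ C K {X φ} → (C ∘ᶜ K) [ X ] ⊢cf φ → C [ K [ X ] ] ⊢cf φ
  nest C K {X} {φ} = subst (_⊢cf φ) (∘ᶜ-[] C K X)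

  unnest : ∀ C K {X φ} → C [ K [ X ] ] ⊢cf φ → (C ∘ᶜ K) [ X ] ⊢cf φ
  unnest C K {X} {φ} = subst (_⊢cf φ) (sym (∘ᶜ-[] C K X))

  Cut : Formula → Set
  Cut ψ = ∀ Δ Γ {φ} → Δ ⊢cf ψ → Γ [ form ψ ] ⊢cf φ → Γ [ Δ ] ⊢cf φ

  CutBelow : Formula → Set
  CutBelow (a ∧' b) = Cut a × Cut b
  CutBelow (a ∨' b) = Cut a × Cut b
  CutBelow (a ⇒ b) = Cut a × Cut b
  CutBelow (a ✱ b) = Cut a × Cut b
  CutBelow (a -✱ b) = Cut a × Cut b
  CutBelow (□ a) = Cut a
  CutBelow ⊤' = ⊤
  CutBelow ⊥' = ⊤
  CutBelow emp = ⊤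
  CutBelow (atom _) = ⊤

  cutInside : ∀ {a Δ χ} → Cut a → ∀ K L → Δ ⊢cf a → K [ L [ form a ] ] ⊢cf χ → K [ L [ Δ ] ] ⊢cf χ
  cutInside cut-a K L D E = nest K L (cut-a _ (K ∘ᶜ L) D (unnest K L E))

  infix 5 _⊢ʳ_
  data _⊢ʳ_ : Bunch → Formula → Set where
    ax   : ∀ a → form (atom a) ⊢ʳ atom a
    empR : ∅m ⊢ʳ emp
    ✱R   : ∀ {Δ₁ Δ₂ a b} → Δ₁ ⊢cf a → Δ₂ ⊢cf b → (Δ₁ ,, Δ₂) ⊢ʳ a ✱ b
    -✱R  : ∀ {Δ a b} → (Δ ,, form a) ⊢cf b → Δ ⊢ʳ a -✱ b
    ⊤R   : ∅a ⊢ʳ ⊤'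
    ∧R   : ∀ {Δ₁ Δ₂ a b} → Δ₁ ⊢cf a → Δ₂ ⊢cf b → (Δ₁ ⨾ Δ₂) ⊢ʳ a ∧' b
    ⇒R   : ∀ {Δ a b} → (Δ ⨾ form a) ⊢cf b → Δ ⊢ʳ a ⇒ b
    ∨R₁  : ∀ {Δ a b} → Δ ⊢cf a → Δ ⊢ʳ a ∨' b
    ∨R₂  : ∀ {Δ a b} → Δ ⊢cf b → Δ ⊢ʳ a ∨' b
    □R   : ∀ {Δ a} → □B Δ ⊢cf a → □B Δ ⊢ʳ □ a

  ⊢ʳ⇒⊢cf : ∀ {Δ ψ} → Δ ⊢ʳ ψ → Δ ⊢cf ψ
  ⊢ʳ⇒⊢cf (ax a) = ax a
  ⊢ʳ⇒⊢cf empR = empR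
  ⊢ʳ⇒⊢cf (✱R D₁ D₂) = ✱R D₁ D₂
  ⊢ʳ⇒⊢cf (-✱R D) = -✱R D
  ⊢ʳ⇒⊢cf ⊤R = ⊤R
  ⊢ʳ⇒⊢cf (∧R D₁ D₂) = ∧R D₁ D₂
  ⊢ʳ⇒⊢cf (⇒R D) = ⇒R D
  ⊢ʳ⇒⊢cf (∨R₁ D) = ∨R₁ D
  ⊢ʳ⇒⊢cf (∨R₂ D) = ∨R₂ D
  ⊢ʳ⇒⊢cf (□R D) = □R D

  ⊬ʳ⊥ : ∀ {Δ} → ¬ (Δ ⊢ʳ ⊥')
  ⊬ʳ⊥ ()

  emp-principal : ∀ {Δ χ} → Δ ⊢ʳ emp → ∀ K → K [ ∅m ] ⊢cf χ → K [ Δ ] ⊢cf χ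
  emp-principal empR K E = E

  ⊤-principal : ∀ {Δ χ} → Δ ⊢ʳ ⊤' → ∀ K → K [ ∅a ] ⊢cf χ → K [ Δ ] ⊢cf χ
  ⊤-principal ⊤R K E = E

  ✱-principal : ∀ {a b Δ χ} → CutBelow (a ✱ b) → Δ ⊢ʳ a ✱ b →
                ∀ K → K [ form a ,, form b ] ⊢cf χ → K [ Δ ] ⊢cf χ
  ✱-principal (cut-a , cut-b) (✱R {Δ₁} D₁ D₂) K E =
    cutInside cut-b K (Δ₁ ,,ʳ hole) D₂ (cutInside cut-a K (hole ,,ˡ form _) D₁ E)

  ∧-principal : ∀ {a b Δ χ} → CutBelow (a ∧' b) → Δ ⊢ʳ a ∧' b →
                ∀ K → K [ form a ⨾ form b ] ⊢cf χ → K [ Δ ] ⊢cf χ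
  ∧-principal (cut-a , cut-b) (∧R {Δ₁} D₁ D₂) K E =
    cutInside cut-b K (Δ₁ ⨾ʳ hole) D₂ (cutInside cut-a K (hole ⨾ˡ form _) D₁ E)

  -✱-principal : ∀ {a b Δ Z₁ Z₂ χ} → CutBelow (a -✱ b) → Δ ⊢ʳ a -✱ b →
                 ∀ K → Z₁ ⊢cf a → K [ Z₂ ,, form b ] ⊢cf χ → K [ (Z₁ ,, Z₂) ,, Δ ] ⊢cf χ
  -✱-principal {Δ = Δ} {Z₂ = Z₂} (cut-a , cut-b) (-✱R D) K F E =
    equiv (cutInside cut-b K (Z₂ ,,ʳ hole) (cut-a _ (Δ ,,ʳ hole) F D) E)
          (≡-ctx K (≡-trans ,-assoc (≡-trans ,-comm ,-assoc)))

  ⇒-principal : ∀ {a b Δ Z₁ Z₂ χ} → CutBelow (a ⇒ b) → Δ ⊢ʳ a ⇒ b →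
                ∀ K → Z₁ ⊢cf a → K [ Z₂ ⨾ form b ] ⊢cf χ → K [ (Z₁ ⨾ Z₂) ⨾ Δ ] ⊢cf χ
  ⇒-principal {Δ = Δ} {Z₂ = Z₂} (cut-a , cut-b) (⇒R D) K F E =
    equiv (cutInside cut-b K (Z₂ ⨾ʳ hole) (cut-a _ (Δ ⨾ʳ hole) F D) E)
          (≡-ctx K (≡-trans ⨾-assoc (≡-trans ⨾-comm ⨾-assoc)))

  ∨-principal : ∀ {a b Δ χ} → CutBelow (a ∨' b) → Δ ⊢ʳ a ∨' b →
                ∀ K → K [ form a ] ⊢cf χ → K [ form b ] ⊢cf χ → K [ Δ ] ⊢cf χ
  ∨-principal (cut-a , _) (∨R₁ D) K E₁ E₂ = cut-a _ K D E₁
  ∨-principal (_ , cut-b) (∨R₂ D) K E₁ E₂ = cut-b _ K D E₂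

  □-principal : ∀ {a Δ χ} → CutBelow (□ a) → Δ ⊢ʳ □ a → ∀ K → K [ form a ] ⊢cf χ → K [ Δ ] ⊢cf χ
  □-principal cut-a (□R D) K E = cut-a _ K D E

  data Boxed : Bunch → Set where
    □ᵇ   : ∀ {a} → Boxed (form (□ a))
    ∅mᵇ  : Boxed ∅m
    ∅aᵇ  : Boxed ∅a
    _,,ᵇ_ : ∀ {X Y} → Boxed X → Boxed Y → Boxed (X ,, Y)
    _⨾ᵇ_  : ∀ {X Y} → Boxed X → Boxed Y → Boxed (X ⨾ Y)

  □B-Boxed : ∀ Y → Boxed (□B Y)
  □B-Boxed (form _) = □ᵇ
  □B-Boxed ∅m = ∅mᵇ
  □B-Boxed ∅a = ∅aᵇ
  □B-Boxed (Y₁ ,, Y₂) = □B-Boxed Y₁ ,,ᵇ □B-Boxed Y₂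
  □B-Boxed (Y₁ ⨾ Y₂) = □B-Boxed Y₁ ⨾ᵇ □B-Boxed Y₂

  Boxed⇒□B : ∀ {X} → Boxed X → Σ[ Y ∈ Bunch ] X ≡ □B Y
  Boxed⇒□B (□ᵇ {a}) = form a , refl
  Boxed⇒□B ∅mᵇ = ∅m , refl
  Boxed⇒□B ∅aᵇ = ∅a , refl
  Boxed⇒□B (b₁ ,,ᵇ b₂) with Boxed⇒□B b₁ | Boxed⇒□B b₂
  ... | Y₁ , refl | Y₂ , refl = (Y₁ ,, Y₂) , refl
  Boxed⇒□B (b₁ ⨾ᵇ b₂) with Boxed⇒□B b₁ | Boxed⇒□B b₂
  ... | Y₁ , refl | Y₂ , refl = (Y₁ ⨾ Y₂) , refl

  □R-Boxed : ∀ {X a} → Boxed X → X ⊢cf a → X ⊢cf □ a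
  □R-Boxed b D with Boxed⇒□B b
  ... | _ , refl = □R D

  ⊢ʳ-Boxed : ∀ {Δ ψ} → Boxed (form ψ) → Δ ⊢ʳ ψ → Boxed Δ
  ⊢ʳ-Boxed □ᵇ (□R {Δ} _) = □B-Boxed Δ

  data MBunch : Set where
    formᵐ : Formula → MBunch
    mark  : MBunch
    ∅mᵐ   : MBunch
    ∅aᵐ   : MBunch
    _,,ᵐ_ : MBunch → MBunch → MBunch
    _⨾ᵐ_  : MBunch → MBunch → MBunch

  data MCtx : Set where
    holeᵐ : MCtx
    _,,ˡᵐ_ : MCtx → MBunch → MCtx
    _,,ʳᵐ_ : MBunch → MCtx → MCtx
    _⨾ˡᵐ_  : MCtx → MBunch → MCtx
    _⨾ʳᵐ_  : MBunch → MCtx → MCtx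

  infixl 25 _⟪_⟫ _⟪_⟫ᶜ
  infixl 30 _⟦_⟧

  _⟦_⟧ : MCtx → MBunch → MBunch
  holeᵐ ⟦ Y ⟧ = Y
  (C ,,ˡᵐ B) ⟦ Y ⟧ = (C ⟦ Y ⟧) ,,ᵐ B
  (B ,,ʳᵐ C) ⟦ Y ⟧ = B ,,ᵐ (C ⟦ Y ⟧)
  (C ⨾ˡᵐ B) ⟦ Y ⟧ = (C ⟦ Y ⟧) ⨾ᵐ B
  (B ⨾ʳᵐ C) ⟦ Y ⟧ = B ⨾ᵐ (C ⟦ Y ⟧)

  _⟪_⟫ : MBunch → Bunch → Bunch
  formᵐ χ ⟪ Z ⟫ = form χ
  mark ⟪ Z ⟫ = Z
  ∅mᵐ ⟪ Z ⟫ = ∅m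
  ∅aᵐ ⟪ Z ⟫ = ∅a
  (B₁ ,,ᵐ B₂) ⟪ Z ⟫ = B₁ ⟪ Z ⟫ ,, B₂ ⟪ Z ⟫
  (B₁ ⨾ᵐ B₂) ⟪ Z ⟫ = B₁ ⟪ Z ⟫ ⨾ B₂ ⟪ Z ⟫

  _⟪_⟫ᶜ : MCtx → Bunch → Ctx
  holeᵐ ⟪ Z ⟫ᶜ = hole
  (C ,,ˡᵐ B) ⟪ Z ⟫ᶜ = C ⟪ Z ⟫ᶜ ,,ˡ B ⟪ Z ⟫
  (B ,,ʳᵐ C) ⟪ Z ⟫ᶜ = B ⟪ Z ⟫ ,,ʳ C ⟪ Z ⟫ᶜ
  (C ⨾ˡᵐ B) ⟪ Z ⟫ᶜ = C ⟪ Z ⟫ᶜ ⨾ˡ B ⟪ Z ⟫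
  (B ⨾ʳᵐ C) ⟪ Z ⟫ᶜ = B ⟪ Z ⟫ ⨾ʳ C ⟪ Z ⟫ᶜ

  ⟦⟧-⟪⟫ : ∀ Z C Y → C ⟦ Y ⟧ ⟪ Z ⟫ ≡ C ⟪ Z ⟫ᶜ [ Y ⟪ Z ⟫ ]
  ⟦⟧-⟪⟫ Z holeᵐ Y = refl
  ⟦⟧-⟪⟫ Z (C ,,ˡᵐ B) Y = cong (_,, B ⟪ Z ⟫) (⟦⟧-⟪⟫ Z C Y)
  ⟦⟧-⟪⟫ Z (B ,,ʳᵐ C) Y = cong (B ⟪ Z ⟫ ,,_) (⟦⟧-⟪⟫ Z C Y)
  ⟦⟧-⟪⟫ Z (C ⨾ˡᵐ B) Y = cong (_⨾ B ⟪ Z ⟫) (⟦⟧-⟪⟫ Z C Y)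
  ⟦⟧-⟪⟫ Z (B ⨾ʳᵐ C) Y = cong (B ⟪ Z ⟫ ⨾_) (⟦⟧-⟪⟫ Z C Y)

  ⟪⟫-Boxed : ∀ {Z Z'} → (Boxed Z → Boxed Z') → ∀ B → Boxed (B ⟪ Z ⟫) → Boxed (B ⟪ Z' ⟫)
  ⟪⟫-Boxed f (formᵐ _) b = b
  ⟪⟫-Boxed f mark b = f b
  ⟪⟫-Boxed f ∅mᵐ b = b
  ⟪⟫-Boxed f ∅aᵐ b = b
  ⟪⟫-Boxed f (B₁ ,,ᵐ B₂) (b₁ ,,ᵇ b₂) = ⟪⟫-Boxed f B₁ b₁ ,,ᵇ ⟪⟫-Boxed f B₂ b₂
  ⟪⟫-Boxed f (B₁ ⨾ᵐ B₂) (b₁ ⨾ᵇ b₂) = ⟪⟫-Boxed f B₁ b₁ ⨾ᵇ ⟪⟫-Boxed f B₂ b₂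

  unmarked : Bunch → MBunch
  unmarked (form χ) = formᵐ χ
  unmarked ∅m = ∅mᵐ
  unmarked ∅a = ∅aᵐ
  unmarked (X ,, Y) = unmarked X ,,ᵐ unmarked Y
  unmarked (X ⨾ Y) = unmarked X ⨾ᵐ unmarked Y

  unmarkedᶜ : Ctx → MCtx
  unmarkedᶜ hole = holeᵐ
  unmarkedᶜ (C ,,ˡ B) = unmarkedᶜ C ,,ˡᵐ unmarked B
  unmarkedᶜ (B ,,ʳ C) = unmarked B ,,ʳᵐ unmarkedᶜ C
  unmarkedᶜ (C ⨾ˡ B) = unmarkedᶜ C ⨾ˡᵐ unmarked B
  unmarkedᶜ (B ⨾ʳ C) = unmarked B ⨾ʳᵐ unmarkedᶜ C

  unmarked-⟪⟫ : ∀ Z X → unmarked X ⟪ Z ⟫ ≡ X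
  unmarked-⟪⟫ Z (form _) = refl
  unmarked-⟪⟫ Z ∅m = refl
  unmarked-⟪⟫ Z ∅a = refl
  unmarked-⟪⟫ Z (X ,, Y) = cong₂ _,,_ (unmarked-⟪⟫ Z X) (unmarked-⟪⟫ Z Y)
  unmarked-⟪⟫ Z (X ⨾ Y) = cong₂ _⨾_ (unmarked-⟪⟫ Z X) (unmarked-⟪⟫ Z Y)

  unmarkedᶜ-⟪⟫ᶜ : ∀ Z C → unmarkedᶜ C ⟪ Z ⟫ᶜ ≡ C
  unmarkedᶜ-⟪⟫ᶜ Z hole = refl
  unmarkedᶜ-⟪⟫ᶜ Z (C ,,ˡ B) = cong₂ _,,ˡ_ (unmarkedᶜ-⟪⟫ᶜ Z C) (unmarked-⟪⟫ Z B)
  unmarkedᶜ-⟪⟫ᶜ Z (B ,,ʳ C) = cong₂ _,,ʳ_ (unmarked-⟪⟫ Z B) (unmarkedᶜ-⟪⟫ᶜ Z C)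
  unmarkedᶜ-⟪⟫ᶜ Z (C ⨾ˡ B) = cong₂ _⨾ˡ_ (unmarkedᶜ-⟪⟫ᶜ Z C) (unmarked-⟪⟫ Z B)
  unmarkedᶜ-⟪⟫ᶜ Z (B ⨾ʳ C) = cong₂ _⨾ʳ_ (unmarked-⟪⟫ Z B) (unmarkedᶜ-⟪⟫ᶜ Z C)

  unmarkedᶜ-mark-⟪⟫ : ∀ Z C → unmarkedᶜ C ⟦ mark ⟧ ⟪ Z ⟫ ≡ C [ Z ]
  unmarkedᶜ-mark-⟪⟫ Z C = trans (⟦⟧-⟪⟫ Z (unmarkedᶜ C) mark) (cong (_[ Z ]) (unmarkedᶜ-⟪⟫ᶜ Z C))

  module _ {ψ : Formula} where

    ⟪⟫≡,, : ∀ B {X Y} → B ⟪ form ψ ⟫ ≡ X ,, Y →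
            Σ[ B₁ ∈ MBunch ] Σ[ B₂ ∈ MBunch ] B ≡ B₁ ,,ᵐ B₂ × B₁ ⟪ form ψ ⟫ ≡ X × B₂ ⟪ form ψ ⟫ ≡ Y
    ⟪⟫≡,, (B₁ ,,ᵐ B₂) refl = B₁ , B₂ , refl , refl , refl
    ⟪⟫≡,, (formᵐ _) ()
    ⟪⟫≡,, mark ()
    ⟪⟫≡,, ∅mᵐ ()
    ⟪⟫≡,, ∅aᵐ ()
    ⟪⟫≡,, (_ ⨾ᵐ _) ()

    ⟪⟫≡⨾ : ∀ B {X Y} → B ⟪ form ψ ⟫ ≡ X ⨾ Y →
           Σ[ B₁ ∈ MBunch ] Σ[ B₂ ∈ MBunch ] B ≡ B₁ ⨾ᵐ B₂ × B₁ ⟪ form ψ ⟫ ≡ X × B₂ ⟪ form ψ ⟫ ≡ Y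
    ⟪⟫≡⨾ (B₁ ⨾ᵐ B₂) refl = B₁ , B₂ , refl , refl , refl
    ⟪⟫≡⨾ (formᵐ _) ()
    ⟪⟫≡⨾ mark ()
    ⟪⟫≡⨾ ∅mᵐ ()
    ⟪⟫≡⨾ ∅aᵐ ()
    ⟪⟫≡⨾ (_ ,,ᵐ _) ()

    ⟪⟫≡∅m : ∀ B → B ⟪ form ψ ⟫ ≡ ∅m → B ≡ ∅mᵐ
    ⟪⟫≡∅m ∅mᵐ refl = refl
    ⟪⟫≡∅m (formᵐ _) ()
    ⟪⟫≡∅m mark ()
    ⟪⟫≡∅m ∅aᵐ ()
    ⟪⟫≡∅m (_ ,,ᵐ _) ()
    ⟪⟫≡∅m (_ ⨾ᵐ _) ()

    ⟪⟫≡∅a : ∀ B → B ⟪ form ψ ⟫ ≡ ∅a → B ≡ ∅aᵐ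
    ⟪⟫≡∅a ∅aᵐ refl = refl
    ⟪⟫≡∅a (formᵐ _) ()
    ⟪⟫≡∅a mark ()
    ⟪⟫≡∅a ∅mᵐ ()
    ⟪⟫≡∅a (_ ,,ᵐ _) ()
    ⟪⟫≡∅a (_ ⨾ᵐ _) ()

    ⟪⟫≡[] : ∀ C B {X} → B ⟪ form ψ ⟫ ≡ C [ X ] →
            Σ[ C' ∈ MCtx ] Σ[ Y ∈ MBunch ] B ≡ C' ⟦ Y ⟧ × C' ⟪ form ψ ⟫ᶜ ≡ C × Y ⟪ form ψ ⟫ ≡ X
    ⟪⟫≡[] hole B e = holeᵐ , B , refl , refl , e
    ⟪⟫≡[] (C ,,ˡ _) B e with ⟪⟫≡,, B e
    ... | B₁ , B₂ , refl , e₁ , refl with ⟪⟫≡[] C B₁ e₁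
    ... | C' , Y , refl , refl , eY = C' ,,ˡᵐ B₂ , Y , refl , refl , eY
    ⟪⟫≡[] (_ ,,ʳ C) B e with ⟪⟫≡,, B e
    ... | B₁ , B₂ , refl , refl , e₂ with ⟪⟫≡[] C B₂ e₂
    ... | C' , Y , refl , refl , eY = B₁ ,,ʳᵐ C' , Y , refl , refl , eY
    ⟪⟫≡[] (C ⨾ˡ _) B e with ⟪⟫≡⨾ B e
    ... | B₁ , B₂ , refl , e₁ , refl with ⟪⟫≡[] C B₁ e₁
    ... | C' , Y , refl , refl , eY = C' ⨾ˡᵐ B₂ , Y , refl , refl , eY
    ⟪⟫≡[] (_ ⨾ʳ C) B e with ⟪⟫≡⨾ B e
    ... | B₁ , B₂ , refl , refl , e₂ with ⟪⟫≡[] C B₂ e₂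
    ... | C' , Y , refl , refl , eY = B₁ ⨾ʳᵐ C' , Y , refl , refl , eY

    data Leaf : Formula → MBunch → Set where
      unmarkedLeaf : ∀ χ → Leaf χ (formᵐ χ)
      markedLeaf   : Leaf ψ mark

    leaf : ∀ B {χ} → B ⟪ form ψ ⟫ ≡ form χ → Leaf χ B
    leaf (formᵐ χ) refl = unmarkedLeaf χ
    leaf mark refl = markedLeaf
    leaf ∅mᵐ ()
    leaf ∅aᵐ ()
    leaf (_ ,,ᵐ _) ()
    leaf (_ ⨾ᵐ _) ()

    data LeafIn : Formula → Ctx → MBunch → Set where
      unmarkedIn : ∀ C χ → LeafIn χ (C ⟪ form ψ ⟫ᶜ) (C ⟦ formᵐ χ ⟧)
      markedIn   : ∀ C → LeafIn ψ (C ⟪ form ψ ⟫ᶜ) (C ⟦ mark ⟧)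

    leafIn : ∀ C B {χ} → B ⟪ form ψ ⟫ ≡ C [ form χ ] → LeafIn χ C B
    leafIn C B e with ⟪⟫≡[] C B e
    ... | C' , Y , refl , refl , eY with leaf Y eY
    ... | unmarkedLeaf χ = unmarkedIn C' χ
    ... | markedLeaf = markedIn C'

  _≈ᵐ_ : MBunch → MBunch → Set
  B ≈ᵐ B' = ∀ Z → B ⟪ Z ⟫ ≡B B' ⟪ Z ⟫

  ⟦⟧-≈ᵐ : ∀ C {Y Y'} → Y ≈ᵐ Y' → C ⟦ Y ⟧ ≈ᵐ C ⟦ Y' ⟧
  ⟦⟧-≈ᵐ C {Y} {Y'} Y≈Y' Z =
    subst₂ _≡B_ (sym (⟦⟧-⟪⟫ Z C Y)) (sym (⟦⟧-⟪⟫ Z C Y')) (≡-ctx (C ⟪ Z ⟫ᶜ) (Y≈Y' Z))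

  Lifts : Formula → Bunch → Bunch → Set
  Lifts ψ X X' = ∀ B → B ⟪ form ψ ⟫ ≡ X → Σ[ B' ∈ MBunch ] B' ⟪ form ψ ⟫ ≡ X' × B ≈ᵐ B'

  module _ {ψ : Formula} where

    lifts-refl : ∀ {X} → Lifts ψ X X
    lifts-refl B e = B , e , λ _ → ≡-refl

    lifts-trans : ∀ {X Y W} → Lifts ψ X Y → Lifts ψ Y W → Lifts ψ X W
    lifts-trans l m B e with l B e
    ... | B' , e' , B≈B' with m B' e'
    ... | B'' , e'' , B'≈B'' = B'' , e'' , λ Z → ≡-trans (B≈B' Z) (B'≈B'' Z)

    lifts-ctx : ∀ C {X X'} → Lifts ψ X X' → Lifts ψ (C [ X ]) (C [ X' ])
    lifts-ctx C l B e with ⟪⟫≡[] C B e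
    ... | C' , Y , refl , refl , eY with l Y eY
    ... | Y' , eY' , Y≈Y' =
      C' ⟦ Y' ⟧ , trans (⟦⟧-⟪⟫ _ C' Y') (cong (C' ⟪ form ψ ⟫ᶜ [_]) eY') , ⟦⟧-≈ᵐ C' Y≈Y'

    ,,-comm-lifts : ∀ {X Y} → Lifts ψ (X ,, Y) (Y ,, X)
    ,,-comm-lifts B e with ⟪⟫≡,, B e
    ... | B₁ , B₂ , refl , refl , refl = B₂ ,,ᵐ B₁ , refl , λ _ → ,-comm

    ,,-assoc-lifts : ∀ {X Y W} → Lifts ψ ((X ,, Y) ,, W) (X ,, (Y ,, W))
    ,,-assoc-lifts B e with ⟪⟫≡,, B e
    ... | B₁₂ , B₃ , refl , e₁₂ , refl with ⟪⟫≡,, B₁₂ e₁₂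
    ... | B₁ , B₂ , refl , refl , refl = B₁ ,,ᵐ (B₂ ,,ᵐ B₃) , refl , λ _ → ,-assoc

    ,,-assoc⁻-lifts : ∀ {X Y W} → Lifts ψ (X ,, (Y ,, W)) ((X ,, Y) ,, W)
    ,,-assoc⁻-lifts B e with ⟪⟫≡,, B e
    ... | B₁ , B₂₃ , refl , refl , e₂₃ with ⟪⟫≡,, B₂₃ e₂₃
    ... | B₂ , B₃ , refl , refl , refl = (B₁ ,,ᵐ B₂) ,,ᵐ B₃ , refl , λ _ → ≡-sym ,-assoc

    ,,-unit-lifts : ∀ {X} → Lifts ψ (X ,, ∅m) X
    ,,-unit-lifts B e with ⟪⟫≡,, B e
    ... | B₁ , B₂ , refl , refl , e₂ with ⟪⟫≡∅m B₂ e₂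
    ... | refl = B₁ , refl , λ _ → ,-unit

    ,,-unit⁻-lifts : ∀ {X} → Lifts ψ X (X ,, ∅m)
    ,,-unit⁻-lifts B e = B ,,ᵐ ∅mᵐ , cong (_,, ∅m) e , λ _ → ≡-sym ,-unit

    ⨾-comm-lifts : ∀ {X Y} → Lifts ψ (X ⨾ Y) (Y ⨾ X)
    ⨾-comm-lifts B e with ⟪⟫≡⨾ B e
    ... | B₁ , B₂ , refl , refl , refl = B₂ ⨾ᵐ B₁ , refl , λ _ → ⨾-comm

    ⨾-assoc-lifts : ∀ {X Y W} → Lifts ψ ((X ⨾ Y) ⨾ W) (X ⨾ (Y ⨾ W))
    ⨾-assoc-lifts B e with ⟪⟫≡⨾ B e
    ... | B₁₂ , B₃ , refl , e₁₂ , refl with ⟪⟫≡⨾ B₁₂ e₁₂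
    ... | B₁ , B₂ , refl , refl , refl = B₁ ⨾ᵐ (B₂ ⨾ᵐ B₃) , refl , λ _ → ⨾-assoc

    ⨾-assoc⁻-lifts : ∀ {X Y W} → Lifts ψ (X ⨾ (Y ⨾ W)) ((X ⨾ Y) ⨾ W)
    ⨾-assoc⁻-lifts B e with ⟪⟫≡⨾ B e
    ... | B₁ , B₂₃ , refl , refl , e₂₃ with ⟪⟫≡⨾ B₂₃ e₂₃
    ... | B₂ , B₃ , refl , refl , refl = (B₁ ⨾ᵐ B₂) ⨾ᵐ B₃ , refl , λ _ → ≡-sym ⨾-assoc

    ⨾-unit-lifts : ∀ {X} → Lifts ψ (X ⨾ ∅a) X
    ⨾-unit-lifts B e with ⟪⟫≡⨾ B e
    ... | B₁ , B₂ , refl , refl , e₂ with ⟪⟫≡∅a B₂ e₂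
    ... | refl = B₁ , refl , λ _ → ⨾-unit

    ⨾-unit⁻-lifts : ∀ {X} → Lifts ψ X (X ⨾ ∅a)
    ⨾-unit⁻-lifts B e = B ⨾ᵐ ∅aᵐ , cong (_⨾ ∅a) e , λ _ → ≡-sym ⨾-unit

    -- Lifting is not symmetric (a unit can only be removed after inverting
    -- the marking), so both directions are proved together for ≡-sym.
    ≡B-lifts : ∀ {X X'} → X ≡B X' → Lifts ψ X X' × Lifts ψ X' X
    ≡B-lifts ≡-refl = lifts-refl , lifts-refl
    ≡B-lifts (≡-sym p) = swap (≡B-lifts p)
    ≡B-lifts (≡-trans p q) with ≡B-lifts p | ≡B-lifts q
    ... | l , l⁻ | m , m⁻ = lifts-trans l m , lifts-trans m⁻ l⁻
    ≡B-lifts (≡-ctx C p) with ≡B-lifts p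
    ... | l , l⁻ = lifts-ctx C l , lifts-ctx C l⁻
    ≡B-lifts ,-comm = ,,-comm-lifts , ,,-comm-lifts
    ≡B-lifts ,-assoc = ,,-assoc-lifts , ,,-assoc⁻-lifts
    ≡B-lifts ,-unit = ,,-unit-lifts , ,,-unit⁻-lifts
    ≡B-lifts ⨾-comm = ⨾-comm-lifts , ⨾-comm-lifts
    ≡B-lifts ⨾-assoc = ⨾-assoc-lifts , ⨾-assoc⁻-lifts
    ≡B-lifts ⨾-unit = ⨾-unit-lifts , ⨾-unit⁻-lifts

  Multicut : Formula → Bunch → Bunch → Formula → Set
  Multicut ψ Δ X φ = ∀ B → B ⟪ form ψ ⟫ ≡ X → B ⟪ Δ ⟫ ⊢cf φ

  premise : ∀ {ψ Δ φ} C Y → Multicut ψ Δ (C ⟪ form ψ ⟫ᶜ [ Y ⟪ form ψ ⟫ ]) φ → C ⟪ Δ ⟫ᶜ [ Y ⟪ Δ ⟫ ] ⊢cf φ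
  premise {φ = φ} C Y cut = subst (_⊢cf φ) (⟦⟧-⟪⟫ _ C Y) (cut (C ⟦ Y ⟧) (⟦⟧-⟪⟫ _ C Y))

  conclude : ∀ {Δ φ} C Y → C ⟪ Δ ⟫ᶜ [ Y ⟪ Δ ⟫ ] ⊢cf φ → C ⟦ Y ⟧ ⟪ Δ ⟫ ⊢cf φ
  conclude {φ = φ} C Y = subst (_⊢cf φ) (sym (⟦⟧-⟪⟫ _ C Y))

  multicut : ∀ {ψ Δ X φ} → CutBelow ψ → Δ ⊢ʳ ψ → X ⊢cf φ → Multicut ψ Δ X φ
  multicut ih rd (ax a) B e with leaf B e
  ... | unmarkedLeaf _ = ax a
  ... | markedLeaf = ⊢ʳ⇒⊢cf rd
  multicut ih rd (equiv E p) B e with proj₁ (≡B-lifts p) B e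
  ... | B' , e' , B≈B' = equiv (multicut ih rd E B' e') (B≈B' _)
  multicut {Δ = Δ} ih rd (W⨾ C E) B e with ⟪⟫≡[] C B e
  ... | C' , Y , refl , refl , eY with ⟪⟫≡⨾ Y eY
  ... | Y₁ , Y₂ , refl , refl , refl =
    conclude C' (Y₁ ⨾ᵐ Y₂) (W⨾ (C' ⟪ Δ ⟫ᶜ) (premise C' Y₁ (multicut ih rd E)))
  multicut {Δ = Δ} ih rd (C⨾ C E) B e with ⟪⟫≡[] C B e
  ... | C' , Y , refl , refl , refl =
    conclude C' Y (C⨾ (C' ⟪ Δ ⟫ᶜ) (premise C' (Y ⨾ᵐ Y) (multicut ih rd E)))
  multicut ih rd empR B e with ⟪⟫≡∅m B e
  ... | refl = empR
  multicut {Δ = Δ} ih rd (empL C E) B e with leafIn C B e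
  ... | unmarkedIn C' _ = conclude C' _ (empL (C' ⟪ Δ ⟫ᶜ) (premise C' ∅mᵐ (multicut ih rd E)))
  ... | markedIn C' = conclude C' mark (emp-principal rd _ (premise C' ∅mᵐ (multicut ih rd E)))
  multicut ih rd (✱R E₁ E₂) B e with ⟪⟫≡,, B e
  ... | B₁ , B₂ , refl , e₁ , e₂ = ✱R (multicut ih rd E₁ B₁ e₁) (multicut ih rd E₂ B₂ e₂)
  multicut {Δ = Δ} ih rd (✱L C {a} {b} E) B e with leafIn C B e
  ... | unmarkedIn C' _ =
    conclude C' _ (✱L (C' ⟪ Δ ⟫ᶜ) (premise C' (formᵐ a ,,ᵐ formᵐ b) (multicut ih rd E)))
  ... | markedIn C' =
    conclude C' mark (✱-principal ih rd _ (premise C' (formᵐ a ,,ᵐ formᵐ b) (multicut ih rd E)))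
  multicut ih rd (-✱R E) B e = -✱R (multicut ih rd E (B ,,ᵐ formᵐ _) (cong (_,, _) e))
  multicut {Δ = Δ} ih rd (-✱L C {ψ = b} F E) B e with ⟪⟫≡[] C B e
  ... | C' , Y , refl , refl , eY with ⟪⟫≡,, Y eY
  ... | Y₁₂ , Y₃ , refl , e₁₂ , e₃ with ⟪⟫≡,, Y₁₂ e₁₂
  ... | Y₁ , Y₂ , refl , refl , refl with leaf Y₃ e₃
  ... | unmarkedLeaf _ =
    conclude C' _ (-✱L (C' ⟪ Δ ⟫ᶜ) (multicut ih rd F Y₁ refl)
                                  (premise C' (Y₂ ,,ᵐ formᵐ b) (multicut ih rd E)))
  ... | markedLeaf =
    conclude C' _ (-✱-principal ih rd _ (multicut ih rd F Y₁ refl)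
                                        (premise C' (Y₂ ,,ᵐ formᵐ b) (multicut ih rd E)))
  multicut ih rd ⊤R B e with ⟪⟫≡∅a B e
  ... | refl = ⊤R
  multicut {Δ = Δ} ih rd (⊤L C E) B e with leafIn C B e
  ... | unmarkedIn C' _ = conclude C' _ (⊤L (C' ⟪ Δ ⟫ᶜ) (premise C' ∅aᵐ (multicut ih rd E)))
  ... | markedIn C' = conclude C' mark (⊤-principal rd _ (premise C' ∅aᵐ (multicut ih rd E)))
  multicut ih rd (∧R E₁ E₂) B e with ⟪⟫≡⨾ B e
  ... | B₁ , B₂ , refl , e₁ , e₂ = ∧R (multicut ih rd E₁ B₁ e₁) (multicut ih rd E₂ B₂ e₂)
  multicut {Δ = Δ} ih rd (∧L C {a} {b} E) B e with leafIn C B e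
  ... | unmarkedIn C' _ =
    conclude C' _ (∧L (C' ⟪ Δ ⟫ᶜ) (premise C' (formᵐ a ⨾ᵐ formᵐ b) (multicut ih rd E)))
  ... | markedIn C' =
    conclude C' mark (∧-principal ih rd _ (premise C' (formᵐ a ⨾ᵐ formᵐ b) (multicut ih rd E)))
  multicut ih rd (⇒R E) B e = ⇒R (multicut ih rd E (B ⨾ᵐ formᵐ _) (cong (_⨾ _) e))
  multicut {Δ = Δ} ih rd (⇒L C {ψ = b} F E) B e with ⟪⟫≡[] C B e
  ... | C' , Y , refl , refl , eY with ⟪⟫≡⨾ Y eY
  ... | Y₁₂ , Y₃ , refl , e₁₂ , e₃ with ⟪⟫≡⨾ Y₁₂ e₁₂
  ... | Y₁ , Y₂ , refl , refl , refl with leaf Y₃ e₃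
  ... | unmarkedLeaf _ =
    conclude C' _ (⇒L (C' ⟪ Δ ⟫ᶜ) (multicut ih rd F Y₁ refl)
                                 (premise C' (Y₂ ⨾ᵐ formᵐ b) (multicut ih rd E)))
  ... | markedLeaf =
    conclude C' _ (⇒-principal ih rd _ (multicut ih rd F Y₁ refl)
                                       (premise C' (Y₂ ⨾ᵐ formᵐ b) (multicut ih rd E)))
  multicut {Δ = Δ} ih rd (⊥L C) B e with leafIn C B e
  ... | unmarkedIn C' _ = conclude C' _ (⊥L (C' ⟪ Δ ⟫ᶜ))
  ... | markedIn C' = ⊥-elim (⊬ʳ⊥ rd)
  multicut ih rd (∨R₁ E) B e = ∨R₁ (multicut ih rd E B e)
  multicut ih rd (∨R₂ E) B e = ∨R₂ (multicut ih rd E B e)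
  multicut {Δ = Δ} ih rd (∨L C {a} {b} E₁ E₂) B e with leafIn C B e
  ... | unmarkedIn C' _ =
    conclude C' _ (∨L (C' ⟪ Δ ⟫ᶜ) (premise C' (formᵐ a) (multicut ih rd E₁))
                                 (premise C' (formᵐ b) (multicut ih rd E₂)))
  ... | markedIn C' =
    conclude C' mark (∨-principal ih rd _ (premise C' (formᵐ a) (multicut ih rd E₁))
                                          (premise C' (formᵐ b) (multicut ih rd E₂)))
  multicut ih rd (□R {Δ = Γ} E) B e =
    □R-Boxed (⟪⟫-Boxed (λ b → ⊢ʳ-Boxed b rd) B (subst Boxed (sym e) (□B-Boxed Γ)))
             (multicut ih rd E B e)
  multicut {Δ = Δ} ih rd (□L C {A = a} E) B e with leafIn C B e
  ... | unmarkedIn C' _ = conclude C' _ (□L (C' ⟪ Δ ⟫ᶜ) (premise C' (formᵐ a) (multicut ih rd E)))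
  ... | markedIn C' = conclude C' mark (□-principal ih rd _ (premise C' (formᵐ a) (multicut ih rd E)))

  cut-⊢ʳ : ∀ {ψ Δ φ} → CutBelow ψ → Δ ⊢ʳ ψ → ∀ Γ → Γ [ form ψ ] ⊢cf φ → Γ [ Δ ] ⊢cf φ
  cut-⊢ʳ {ψ} {Δ} {φ} ih rd Γ E =
    subst (_⊢cf φ) (unmarkedᶜ-mark-⟪⟫ Δ Γ)
      (multicut ih rd E (unmarkedᶜ Γ ⟦ mark ⟧) (unmarkedᶜ-mark-⟪⟫ (form ψ) Γ))

  CutBelow⇒Cut : ∀ {ψ} → CutBelow ψ → Cut ψ
  CutBelow⇒Cut ih Δ Γ (ax a) E = cut-⊢ʳ ih (ax a) Γ E
  CutBelow⇒Cut ih Δ Γ (equiv D p) E = equiv (CutBelow⇒Cut ih _ Γ D E) (≡-ctx Γ p)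
  CutBelow⇒Cut ih Δ Γ (W⨾ C D) E = nest Γ C (W⨾ (Γ ∘ᶜ C) (unnest Γ C (CutBelow⇒Cut ih _ Γ D E)))
  CutBelow⇒Cut ih Δ Γ (C⨾ C D) E = nest Γ C (C⨾ (Γ ∘ᶜ C) (unnest Γ C (CutBelow⇒Cut ih _ Γ D E)))
  CutBelow⇒Cut ih Δ Γ empR E = cut-⊢ʳ ih empR Γ E
  CutBelow⇒Cut ih Δ Γ (empL C D) E = nest Γ C (empL (Γ ∘ᶜ C) (unnest Γ C (CutBelow⇒Cut ih _ Γ D E)))
  CutBelow⇒Cut ih Δ Γ (✱R D₁ D₂) E = cut-⊢ʳ ih (✱R D₁ D₂) Γ E
  CutBelow⇒Cut ih Δ Γ (✱L C D) E = nest Γ C (✱L (Γ ∘ᶜ C) (unnest Γ C (CutBelow⇒Cut ih _ Γ D E)))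
  CutBelow⇒Cut ih Δ Γ (-✱R D) E = cut-⊢ʳ ih (-✱R D) Γ E
  CutBelow⇒Cut ih Δ Γ (-✱L C F D) E = nest Γ C (-✱L (Γ ∘ᶜ C) F (unnest Γ C (CutBelow⇒Cut ih _ Γ D E)))
  CutBelow⇒Cut ih Δ Γ ⊤R E = cut-⊢ʳ ih ⊤R Γ E
  CutBelow⇒Cut ih Δ Γ (⊤L C D) E = nest Γ C (⊤L (Γ ∘ᶜ C) (unnest Γ C (CutBelow⇒Cut ih _ Γ D E)))
  CutBelow⇒Cut ih Δ Γ (∧R D₁ D₂) E = cut-⊢ʳ ih (∧R D₁ D₂) Γ E
  CutBelow⇒Cut ih Δ Γ (∧L C D) E = nest Γ C (∧L (Γ ∘ᶜ C) (unnest Γ C (CutBelow⇒Cut ih _ Γ D E)))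
  CutBelow⇒Cut ih Δ Γ (⇒R D) E = cut-⊢ʳ ih (⇒R D) Γ E
  CutBelow⇒Cut ih Δ Γ (⇒L C F D) E = nest Γ C (⇒L (Γ ∘ᶜ C) F (unnest Γ C (CutBelow⇒Cut ih _ Γ D E)))
  CutBelow⇒Cut ih Δ Γ (⊥L C) E = nest Γ C (⊥L (Γ ∘ᶜ C))
  CutBelow⇒Cut ih Δ Γ (∨R₁ D) E = cut-⊢ʳ ih (∨R₁ D) Γ E
  CutBelow⇒Cut ih Δ Γ (∨R₂ D) E = cut-⊢ʳ ih (∨R₂ D) Γ E
  CutBelow⇒Cut ih Δ Γ (∨L C D₁ D₂) E =
    nest Γ C (∨L (Γ ∘ᶜ C) (unnest Γ C (CutBelow⇒Cut ih _ Γ D₁ E))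
                          (unnest Γ C (CutBelow⇒Cut ih _ Γ D₂ E)))
  CutBelow⇒Cut ih Δ Γ (□R D) E = cut-⊢ʳ ih (□R D) Γ E
  CutBelow⇒Cut ih Δ Γ (□L C D) E = nest Γ C (□L (Γ ∘ᶜ C) (unnest Γ C (CutBelow⇒Cut ih _ Γ D E)))

  cut-admissible : ∀ ψ → Cut ψ
  cutBelow : ∀ ψ → CutBelow ψ

  cut-admissible ψ = CutBelow⇒Cut (cutBelow ψ)

  cutBelow ⊤' = tt
  cutBelow ⊥' = tt
  cutBelow emp = tt
  cutBelow (atom _) = tt
  cutBelow (a ∧' b) = cut-admissible a , cut-admissible b
  cutBelow (a ∨' b) = cut-admissible a , cut-admissible b
  cutBelow (a ⇒ b) = cut-admissible a , cut-admissible b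
  cutBelow (a ✱ b) = cut-admissible a , cut-admissible b
  cutBelow (a -✱ b) = cut-admissible a , cut-admissible b
  cutBelow (□ a) = cut-admissible a

theorem8p6 : (Atom : Set) → let open BIS4 Atom in
    (Δ : Bunch) (Γ : Ctx) (ψ φ : Formula) →
    Δ ⊢cf ψ → Γ [ form ψ ] ⊢cf φ → Γ [ Δ ] ⊢cf φ
theorem8p6 Atom Δ Γ ψ φ = CutAdmissibility.cut-admissible Atom ψ Δ Γ
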